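{- Let $G$ be a finite abelian group, $H_1,H_2$ subgroups of $G$ with $H=H_1\cap H_2$, and $a,b$ positive integers. Suppose there exists an IMRS$^*_{G\setminus(H_1\cup H_2)}(a,b;|G\setminus(H_1\cup H_2)|/(ab))$. If there exist an IMRS$^*_{H_1\setminus H}(a,b;|H_1\setminus H|/(ab))$ and an MRS$^*_{H_2}(a,b;|H_2|/(ab))$, then there exists an MRS$^*_G(a,b;|G|/(ab))$.
   Context: For a finite abelian group $(K,+)$ and a subset $T\subseteq K$ with $|T|=xyz$, an IMRS$^*_{T}(x,y;z)$ is a collection of $z$ arrays of size $x\times y$ whose entries are elements of $T$, each element of $T$ appearing exactly once among all the arrays, such that every row sum and every column sum in every array equals $0\in K$. An MRS$^*_K(x,y;z)$ is the same notion with $T=K$. -}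

module Defs where

open import Level using (Level; _⊔_)
open import Data.Nat using (ℕ)
open import Data.Fin using (Fin; zero; suc)
open import Data.Product using (Σ; _×_; ∃; ∃-syntax; _,_)
open import Relation.Nullary using (¬_)
open import Relation.Unary using (Pred)
open import Relation.Binary.PropositionalEquality as ≡ using (_≡_)
open import Algebra.Bundles using (AbelianGroup)
open import Function.Bundles using (Bijection)

record FiniteAbelianGroup (c ℓ : Level) : Set (Level.suc (c ⊔ ℓ)) where
  field
    abGroup : AbelianGroup c ℓ
    order : ℕ
  open AbelianGroup abGroup public
  field
    enum : Bijection (≡.setoid (Fin order)) setoid

module _ {c ℓ : Level} (G : FiniteAbelianGroup c ℓ) where
  open FiniteAbelianGroup G

  sumG : {m : ℕ} → (Fin m → Carrier) → Carrier
  sumG {ℕ.zero}  f = ε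
  sumG {ℕ.suc m} f = f zero ∙ sumG (λ i → f (suc i))

  record IsSubgroup {p : Level} (H : Pred Carrier p) : Set (c ⊔ ℓ ⊔ p) where
    field
      resp  : ∀ {x y} → x ≈ y → H x → H y
      has-ε : H ε
      ∙-closed : ∀ {x y} → H x → H y → H (x ∙ y)
      ⁻¹-closed : ∀ {x} → H x → H (x ⁻¹)

  -- IMRS*_T(x,y;z): z arrays of size x×y (array k, row i, column j),
  -- entries in T, every element of T appearing exactly once among all
  -- entries, every row and column sum equal to 0.
  IMRS* : {p : Level} (T : Pred Carrier p) (x y z : ℕ) → Set (c ⊔ ℓ ⊔ p)
  IMRS* T x y z =
    Σ (Fin z → Fin x → Fin y → Carrier) λ A →
        (∀ k i j → T (A k i j))
      × (∀ k i j k' i' j' → A k i j ≈ A k' i' j' → (k ≡ k') × (i ≡ i') × (j ≡ j'))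
      × (∀ t → T t → ∃[ k ] ∃[ i ] ∃[ j ] (A k i j ≈ t))
      × (∀ k i → sumG (λ j → A k i j) ≈ ε)
      × (∀ k j → sumG (λ i → A k i j) ≈ ε)

  MRS* : (x y z : ℕ) → Set (c ⊔ ℓ)
  MRS* = IMRS* {Level.zero} (λ _ → Data.Unit.⊤)
    where import Data.Unit

{-# OPTIONS --safe #-}
module Submission where

open import Defs
open import Level using (Level)
open import Data.Nat using (ℕ; _*_; _/_; NonZero)
open import Data.Product using (_×_; ∃-syntax)
open import Relation.Nullary using (¬_)
open import Relation.Unary using (Pred)
open import Data.Nat.Properties using (m*n≢0)

open import Data.Nat using (_+_)
open import Data.Nat.DivMod using (m*n/n≡m)
open import Data.Product using (_,_; proj₁; proj₂)
open import Data.Product.Function.NonDependent.Propositional using (_×-↔_)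
open import Data.Sum using (_⊎_; inj₁; inj₂; [_,_]′)
open import Data.Empty using (⊥; ⊥-elim)
open import Data.Unit using (tt)
open import Data.Fin using (Fin; splitAt; join)
open import Data.Fin.Properties using (_≟_; any?; splitAt-join; join-splitAt; *↔×)
open import Data.Fin.Permutation using (↔⇒≡)
open import Function using (_↔_; mk↔ₛ′)
open import Function.Properties.Inverse using (↔-refl; ↔-trans)
open import Relation.Nullary using (Dec; yes; no)
open import Relation.Unary using (Decidable; _≐_)
open import Relation.Binary.PropositionalEquality as ≡ using (_≡_)
open import Function.Bundles using (Bijection)

-- G is the disjoint union of G ∖ (H₁ ∪ H₂), H₁ ∖ H and H₂, so putting the
-- three families of arrays side by side yields z₁ + z₂ + z₃ arrays whose
-- entries run over G exactly once; counting entries then shows that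
-- z₁ + z₂ + z₃ = |G| / (ab).  Constructively, splitting G into these three
-- parts needs decidable membership, which the given arrays provide: each
-- part is the image of a finite array.

module _ {c ℓ : Level} (G : FiniteAbelianGroup c ℓ) where
  open FiniteAbelianGroup G
  open Bijection enum using (to; injective; strictlySurjective)

  _≈?_ : (x y : Carrier) → Dec (x ≈ y)
  x ≈? y with strictlySurjective x | strictlySurjective y
  ... | i , toi≈x | j , toj≈y with i ≟ j
  ... | yes ≡.refl = yes (trans (sym toi≈x) toj≈y)
  ... | no i≢j     = no λ x≈y → i≢j (injective (trans toi≈x (trans x≈y (sym toj≈y))))

  IMRS*⇒Decidable : {p : Level} {T : Pred Carrier p} {a b z : ℕ} →
    (∀ {x y} → x ≈ y → T x → T y) → IMRS* G T a b z → Decidable T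
  IMRS*⇒Decidable resp (A , mem , _ , cov , _) t
    with any? (λ k → any? (λ i → any? (λ j → A k i j ≈? t)))
  ... | yes (k , i , j , Akij≈t) = yes (resp Akij≈t (mem k i j))
  ... | no ¬hit                  = no λ Tt → ¬hit (cov t Tt)

  IMRS*-resp-≐ : {p q : Level} {T : Pred Carrier p} {U : Pred Carrier q} {a b z : ℕ} →
    T ≐ U → IMRS* G T a b z → IMRS* G U a b z
  IMRS*-resp-≐ (T⊆U , U⊆T) (A , mem , inj , cov , row , col) =
    A , (λ k i j → T⊆U (mem k i j)) , inj , (λ t Ut → cov t (U⊆T Ut)) , row , col

  IMRS*-⊎ : {p q : Level} {T : Pred Carrier p} {U : Pred Carrier q} {a b z w : ℕ} →
    (∀ {x y} → x ≈ y → T x → U y → ⊥) →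
    IMRS* G T a b z → IMRS* G U a b w → IMRS* G (λ g → T g ⊎ U g) a b (z + w)
  IMRS*-⊎ {T = T} {U} {a} {b} {z} {w} disjoint
    (A , memA , injA , covA , rowA , colA) (B , memB , injB , covB , rowB , colB) =
    C , memC , injC , covC , rowC , colC
    where
    pick : Fin z ⊎ Fin w → Fin a → Fin b → Carrier
    pick = [ A , B ]′

    C : Fin (z + w) → Fin a → Fin b → Carrier
    C k = pick (splitAt z k)

    memPick : ∀ s i j → T (pick s i j) ⊎ U (pick s i j)
    memPick (inj₁ k) i j = inj₁ (memA k i j)
    memPick (inj₂ k) i j = inj₂ (memB k i j)

    injPick : ∀ s i j s' i' j' → pick s i j ≈ pick s' i' j' → (s ≡ s') × (i ≡ i') × (j ≡ j')
    injPick (inj₁ k) i j (inj₁ k') i' j' e with injA k i j k' i' j' e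
    ... | ≡.refl , same = ≡.refl , same
    injPick (inj₂ k) i j (inj₂ k') i' j' e with injB k i j k' i' j' e
    ... | ≡.refl , same = ≡.refl , same
    injPick (inj₁ k) i j (inj₂ k') i' j' e = ⊥-elim (disjoint e (memA k i j) (memB k' i' j'))
    injPick (inj₂ k) i j (inj₁ k') i' j' e = ⊥-elim (disjoint (sym e) (memA k' i' j') (memB k i j))

    covPick : ∀ t → T t ⊎ U t → ∃[ s ] ∃[ i ] ∃[ j ] (pick s i j ≈ t)
    covPick t (inj₁ Tt) with k , ij≈t ← covA t Tt = inj₁ k , ij≈t
    covPick t (inj₂ Ut) with k , ij≈t ← covB t Ut = inj₂ k , ij≈t

    memC : ∀ k i j → T (C k i j) ⊎ U (C k i j)
    memC k = memPick (splitAt z k)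

    injC : ∀ k i j k' i' j' → C k i j ≈ C k' i' j' → (k ≡ k') × (i ≡ i') × (j ≡ j')
    injC k i j k' i' j' e with injPick (splitAt z k) i j (splitAt z k') i' j' e
    ... | s≡s' , same =
      ≡.trans (≡.sym (join-splitAt z w k))
        (≡.trans (≡.cong (join z w) s≡s') (join-splitAt z w k')) , same

    covC : ∀ t → T t ⊎ U t → ∃[ k ] ∃[ i ] ∃[ j ] (C k i j ≈ t)
    covC t Tt⊎Ut with s , i , j , e ← covPick t Tt⊎Ut =
      join z w s , i , j , ≡.subst (λ s' → pick s' i j ≈ t) (≡.sym (splitAt-join z w s)) e

    rowC : ∀ k i → sumG G (λ j → C k i j) ≈ ε
    rowC k with splitAt z k
    ... | inj₁ k' = rowA k'
    ... | inj₂ k' = rowB k'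

    colC : ∀ k j → sumG G (λ i → C k i j) ≈ ε
    colC k with splitAt z k
    ... | inj₁ k' = colA k'
    ... | inj₂ k' = colB k'

  MRS*-entries↔ : {a b z : ℕ} → MRS* G a b z → (Fin z × (Fin a × Fin b)) ↔ Fin order
  MRS*-entries↔ {a} {b} {z} (A , _ , inj , cov , _) = mk↔ₛ′ index position index∘position position∘index
    where
    index : Fin z × (Fin a × Fin b) → Fin order
    index (k , i , j) = proj₁ (strictlySurjective (A k i j))
    position : Fin order → Fin z × (Fin a × Fin b)
    position x with k , i , j , _ ← cov (to x) tt = k , i , j
    index∘position : ∀ x → index (position x) ≡ x
    index∘position x with k , i , j , Akij≈x ← cov (to x) tt =
      injective (trans (proj₂ (strictlySurjective (A k i j))) Akij≈x)
    position∘index : ∀ e → position (index e) ≡ e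
    position∘index (k , i , j) with cov (to (index (k , i , j))) tt
    ... | k' , i' , j' , e
      with inj k' i' j' k i j (trans e (proj₂ (strictlySurjective (A k i j))))
    ... | ≡.refl , ≡.refl , ≡.refl = ≡.refl

  MRS*⇒order≡ : {a b z : ℕ} → MRS* G a b z → order ≡ z * (a * b)
  MRS*⇒order≡ M = ≡.sym (↔⇒≡ (↔-trans *↔× (↔-trans (↔-refl ×-↔ *↔×) (MRS*-entries↔ M))))

  module Partition {p : Level} {H₁ H₂ : Pred Carrier p}
    (resp₁ : ∀ {x y} → x ≈ y → H₁ x → H₁ y) (resp₂ : ∀ {x y} → x ≈ y → H₂ x → H₂ y) where

    Outside Difference : Pred Carrier p
    Outside g    = ¬ H₁ g × ¬ H₂ g
    Difference g = H₁ g × ¬ (H₁ g × H₂ g)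

    Difference-resp : ∀ {x y} → x ≈ y → Difference x → Difference y
    Difference-resp x≈y (H₁x , ¬H₁H₂x) =
      resp₁ x≈y H₁x , λ (H₁y , H₂y) → ¬H₁H₂x (resp₁ (sym x≈y) H₁y , resp₂ (sym x≈y) H₂y)

    Outside-Difference-disjoint : ∀ {x y} → x ≈ y → Outside x → Difference y → ⊥
    Outside-Difference-disjoint x≈y (¬H₁x , _) (H₁y , _) = ¬H₁x (resp₁ (sym x≈y) H₁y)

    Outside∪Difference-H₂-disjoint : ∀ {x y} → x ≈ y → Outside x ⊎ Difference x → H₂ y → ⊥
    Outside∪Difference-H₂-disjoint x≈y (inj₁ (_ , ¬H₂x))   H₂y = ¬H₂x (resp₂ (sym x≈y) H₂y)
    Outside∪Difference-H₂-disjoint x≈y (inj₂ (H₁x , ¬H₁H₂x)) H₂y = ¬H₁H₂x (H₁x , resp₂ (sym x≈y) H₂y)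

    partition : ∀ g → Dec (H₂ g) → Dec (Difference g) → (Outside g ⊎ Difference g) ⊎ H₂ g
    partition g (yes H₂g) _         = inj₂ H₂g
    partition g (no ¬H₂g) (yes D)   = inj₁ (inj₂ D)
    partition g (no ¬H₂g) (no ¬D)   = inj₁ (inj₁ ((λ H₁g → ¬D (H₁g , λ (_ , H₂g) → ¬H₂g H₂g)) , ¬H₂g))

mainTheorem10 : {c ℓ p : Level} (G : FiniteAbelianGroup c ℓ)
    (H₁ H₂ : Pred (FiniteAbelianGroup.Carrier G) p) →
    IsSubgroup G H₁ → IsSubgroup G H₂ →
    (a b : ℕ) → .{{_ : NonZero a}} → .{{_ : NonZero b}} →
    -- IMRS* on G \ (H₁ ∪ H₂)
    ∃[ z ] IMRS* G (λ g → ¬ H₁ g × ¬ H₂ g) a b z →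
    -- IMRS* on H₁ \ H, where H = H₁ ∩ H₂
    ∃[ z ] IMRS* G (λ g → H₁ g × ¬ (H₁ g × H₂ g)) a b z →
    -- MRS* on H₂
    ∃[ z ] IMRS* G H₂ a b z →
    MRS* G a b (_/_ (FiniteAbelianGroup.order G) (a * b) {{m*n≢0 a b}})
mainTheorem10 G H₁ H₂ S₁ S₂ a b (z₁ , I₁) (z₂ , I₂) (z₃ , I₃) =
  ≡.subst (MRS* G a b) (≡.sym order/ab≡z) M
  where
  open FiniteAbelianGroup G using (order)
  open Partition G (IsSubgroup.resp S₁) (IsSubgroup.resp S₂)

  total : ∀ g → (Outside g ⊎ Difference g) ⊎ H₂ g
  total g = partition g (IMRS*⇒Decidable G (IsSubgroup.resp S₂) I₃ g)
                        (IMRS*⇒Decidable G Difference-resp I₂ g)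

  M : MRS* G a b (z₁ + z₂ + z₃)
  M = IMRS*-resp-≐ G ((λ _ → tt) , λ {g} _ → total g)
        (IMRS*-⊎ G Outside∪Difference-H₂-disjoint (IMRS*-⊎ G Outside-Difference-disjoint I₁ I₂) I₃)

  order/ab≡z : _/_ order (a * b) {{m*n≢0 a b}} ≡ z₁ + z₂ + z₃
  order/ab≡z = ≡.trans (≡.cong (λ n → _/_ n (a * b) {{m*n≢0 a b}}) (MRS*⇒order≡ G M))
                       (m*n/n≡m (z₁ + z₂ + z₃) (a * b) {{m*n≢0 a b}})
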